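{- Let $\mathcal{D}$ be a database, $\mathcal{R}$ a rule set, $\delta$ an $\mathcal{R}$-derivation from $\mathcal{D}$ deriving $\mathcal{I}$, and $\Sigma$ any reduction sequence applicable to $G_\delta$, with $\Sigma(G_\delta)=(\mathrm{V},\mathrm{E},\mathrm{At},\mathrm{L})$. Then: (1) for every $x\in\overline C(\mathcal{I})$ there is a unique $x$-generative node in $\mathrm{V}$; (2) if $X_n$ is the $x$-generative node, then for every $X_k\in\mathrm{V}$ with $x\in\overline C(X_k)$ there is a directed path from $X_n$ to $X_k$ in $\Sigma(G_\delta)$ such that every node $X_\ell$ on the path satisfies $\ell\le k$ and $x\in\overline C(X_\ell)$.
   Context: Terms: constants, variables, nulls. An instance is a set of atoms over constants and nulls; a database a finite set of atoms over constants. $\mathbf{T}(\mathcal{X})$ is the set of terms of a set of atoms. A homomorphism between sets of atoms is a term map, identity on constants, sending atoms to atoms. A rule $\rho=\forall\vec x\vec y(\varphi(\vec x,\vec y)\to\exists\vec z\,\psi(\vec y,\vec z))$ has body $\varphi$ and head $\psi$; frontier $\mathit{fr}(\rho)$ = variables in both; a frontier atom is a body atom containing a frontier variable. A rule set is a finite set of rules; $C=\mathbf{C}(\mathcal{D},\mathcal{R})$ = constants of $\mathcal{D}$ or $\mathcal{R}$. An $\mathcal{R}$-derivation from $\mathcal{D}$ is $\delta=\mathcal{D}=\mathcal{I}_0,(\rho_1,h_1,\mathcal{I}_1),\dots,(\rho_n,h_n,\mathcal{I}_n)$ with $\rho_i\in\mathcal{R}$, $h_i$ a homomorphism from $\mathit{body}(\rho_i)$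 to $\mathcal{I}_{i-1}$, $\mathcal{I}_i=\mathcal{I}_{i-1}\cup\overline h_i(\mathit{head}(\rho_i))$ with $\overline h_i$ extending $h_i$ by fresh nulls for existential variables; it derives $\mathcal{I}=\mathcal{I}_n$. Derivation graph $G_\delta=(\mathrm{V},\mathrm{E},\mathrm{At},\mathrm{L})$: $\mathrm{V}=\{X_0,\dots,X_n\}$, $\mathrm{At}(X_0)=\mathcal{D}$, $\mathrm{At}(X_i)=\mathcal{I}_i\setminus\mathcal{I}_{i-1}$; $(X_i,X_j)\in\mathrm{E}$ iff some atom of $\mathrm{At}(X_i)$ equals $h_j(a)$ for a frontier atom $a$ of $\rho_j$, with $\mathrm{L}(X_i,X_j)=h_j(\mathrm{vars}(a)\cap\mathit{fr}(\rho_j))\setminus C$ (collected over such $a$). $\mathbf{T}(X)=\mathbf{T}(\mathrm{At}(X))\cup C$, $\overline C(X)=\mathbf{T}(X)\setminus C$, $\overline C(\mathcal{I})=\mathbf{T}(\mathcal{I})\setminus C$. Reduction operations (changing only arcs and labels): (ar) delete an arc with empty label; (tr) if $(X_i,X_k),(X_j,X_k)\in\mathrm{E}$, $X_i\neq X_j$, $t\in\mathrm{L}(X_i,X_k)\cap\mathrm{L}(X_j,X_k)$, remove $t$ from $\mathrm{L}(X_j,X_k)$; (cr) if $(X_i,X_k),(X_j,X_k)\in\mathrm{E}$ and some $X_\ell$ with $\ell<k$ has $\mathrm{L}(X_i,X_k)\cup\mathrm{L}(X_j,X_k)\subseteq\mathbf{T}(X_\ell)$, replace these two arcs by $(X_\ell,X_k)$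 labelled $\mathrm{L}(X_i,X_k)\cup\mathrm{L}(X_j,X_k)$. A reduction sequence is a finite sequence of such operations, applicable if each condition holds when applied. A node $X_n$ of $\Sigma(G_\delta)$ is $x$-generative (for $x\in\overline C(\mathcal{I})$) iff $x\in\overline C(X_n)$ and for every node $X_k$ with $x\in\overline C(X_k)$ we have $n\le k$. -}

module Defs where

open import Level using (0ℓ)
open import Data.Nat using (ℕ; zero; suc; _<_; _≤_)
open import Data.List using (List; []; _∷_; _++_; map; concat; take; length)
open import Data.List.Membership.Propositional using (_∈_; _∉_)
open import Data.Product using (Σ; ∃; _×_; _,_)
open import Data.Sum using (_⊎_)
open import Data.Maybe using (Maybe; just; nothing)
open import Relation.Nullary using (¬_)
open import Data.Empty using (⊥)
open import Relation.Binary.PropositionalEquality using (_≡_; _≢_)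

-- Terms, atoms, sets of atoms (finite sets represented by lists,
-- read with set semantics via membership _∈_)

data Term : Set where
  cst : ℕ → Term
  var : ℕ → Term
  nul : ℕ → Term

record Atom : Set where
  constructor atom
  field
    pred : ℕ
    args : List Term
open Atom public

_∈T_ : Term → List Atom → Set
t ∈T As = ∃ λ a → a ∈ As × t ∈ args a

IsConst : Term → Set
IsConst t = ∃ λ c → t ≡ cst c

Database : List Atom → Set
Database D = ∀ t → t ∈T D → IsConst t

-- Rules  ∀x⃗y⃗ (body → ∃z⃗ head); variables of the body are x⃗,y⃗, of the
-- head y⃗,z⃗; rules contain constants and variables but no nulls.

record Rule : Set where
  constructor mkRule
  field
    body : List Atom
    head : List Atom
open Rule public

RuleWF : Rule → Set
RuleWF ρ = (∀ m → ¬ (nul m ∈T body ρ)) × (∀ m → ¬ (nul m ∈T head ρ))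

Frontier : Rule → ℕ → Set
Frontier ρ v = (var v ∈T body ρ) × (var v ∈T head ρ)

Existential : Rule → ℕ → Set
Existential ρ z = (var z ∈T head ρ) × ¬ (var z ∈T body ρ)

FrontierAtom : Rule → Atom → Set
FrontierAtom ρ a = a ∈ body ρ × ∃ λ v → var v ∈ args a × Frontier ρ v

-- Homomorphisms (term maps, identity on constants; rules have no nulls,
-- so a map on variables suffices)

substT : (ℕ → Term) → Term → Term
substT h (cst c) = cst c
substT h (var v) = h v
substT h (nul m) = nul m

substA : (ℕ → Term) → Atom → Atom
substA h (atom p ts) = atom p (map (substT h) ts)

record Step : Set where
  constructor mkStep
  field
    rl : Rule
    h  : ℕ → Term
    hb : ℕ → Term      -- its extension h̄ᵢ by fresh nulls
open Step public

stepAt : List Step → ℕ → Maybe Step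
stepAt []       _       = nothing
stepAt (s ∷ ss) zero    = just s
stepAt (s ∷ ss) (suc i) = stepAt ss i

produced : Step → List Atom
produced s = map (substA (hb s)) (head (rl s))

inst : List Atom → List Step → ℕ → List Atom
inst D ss i = D ++ concat (map produced (take i ss))

ValidStep : List Rule → List Atom → Step → Set
ValidStep R I s =
  (rl s ∈ R) ×
  (∀ a → a ∈ body (rl s) → substA (h s) a ∈ I) ×
  (∀ v → var v ∈T body (rl s) → hb s v ≡ h s v) ×
  (∀ z → Existential (rl s) z → ∃ λ m → hb s z ≡ nul m × ¬ (nul m ∈T I)) ×
  (∀ z z' → Existential (rl s) z → Existential (rl s) z' → z ≢ z' → hb s z ≢ hb s z')

ValidDeriv : List Rule → List Atom → List Step → Set
ValidDeriv R D ss = ∀ i s → stepAt ss i ≡ just s → ValidStep R (inst D ss i) s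

-- Labelled graphs over nodes X₀ … X_N (nodes are indices k ≤ N, the
-- atom map At is fixed by the derivation; only arcs and labels change).

record LGraph : Set₁ where
  constructor mkLGraph
  field
    E : ℕ → ℕ → Set
    L : ℕ → ℕ → Term → Set
open LGraph public

data Path (E : ℕ → ℕ → Set) (P : ℕ → Set) : ℕ → ℕ → Set where
  here : ∀ {a} → P a → Path E P a a
  step : ∀ {a b c} → P a → E a b → Path E P b c → Path E P a c

module _ (R : List Rule) (D : List Atom) (ss : List Step) where

  N : ℕ
  N = length ss

  InC : Term → Set
  InC t = IsConst t ×
          ((t ∈T D) ⊎ (∃ λ ρ → ρ ∈ R × ((t ∈T body ρ) ⊎ (t ∈T head ρ))))

  -- At(X₀) = D, At(Xᵢ₊₁) = Iᵢ₊₁ ∖ Iᵢ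
  AtX : ℕ → Atom → Set
  AtX zero    a = a ∈ D
  AtX (suc i) a = ∃ λ s → stepAt ss i ≡ just s × a ∈ produced s × a ∉ inst D ss i

  TX : ℕ → Term → Set
  TX k t = (∃ λ a → AtX k a × t ∈ args a) ⊎ InC t

  CbarX : ℕ → Term → Set
  CbarX k t = TX k t × ¬ InC t

  CbarI : Term → Set
  CbarI t = (t ∈T inst D ss N) × ¬ InC t

  E₀ : ℕ → ℕ → Set
  E₀ i zero    = ⊥
  E₀ i (suc j) = ∃ λ s → stepAt ss j ≡ just s ×
                 ∃ λ a → FrontierAtom (rl s) a × AtX i (substA (h s) a)

  L₀ : ℕ → ℕ → Term → Set
  L₀ i zero    t = ⊥
  L₀ i (suc j) t = ∃ λ s → stepAt ss j ≡ just s ×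
                   ∃ λ a → FrontierAtom (rl s) a × AtX i (substA (h s) a) ×
                   ∃ λ v → var v ∈ args a × Frontier (rl s) v ×
                   t ≡ h s v × ¬ InC t

  Gδ : LGraph
  Gδ = mkLGraph E₀ L₀

  arOp : LGraph → ℕ → ℕ → LGraph
  arOp G i k = mkLGraph (λ a b → E G a b × ¬ (a ≡ i × b ≡ k))
                        (λ a b u → L G a b u × ¬ (a ≡ i × b ≡ k))

  trOp : LGraph → ℕ → ℕ → Term → LGraph
  trOp G j k t = mkLGraph (E G) (λ a b u → L G a b u × ¬ (a ≡ j × b ≡ k × u ≡ t))

  -- replace arcs (i,k),(j,k) by (ℓ,k) labelled L(i,k) ∪ L(j,k)
  -- (united with the previous label of (ℓ,k) if that arc already existed)
  crOp : LGraph → ℕ → ℕ → ℕ → ℕ → LGraph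
  crOp G i j k ℓ = mkLGraph
    (λ a b → (E G a b × ¬ (a ≡ i × b ≡ k) × ¬ (a ≡ j × b ≡ k)) ⊎ (a ≡ ℓ × b ≡ k))
    (λ a b u → (¬ (a ≡ ℓ × b ≡ k) × L G a b u × ¬ (a ≡ i × b ≡ k) × ¬ (a ≡ j × b ≡ k))
             ⊎ (a ≡ ℓ × b ≡ k × ((E G ℓ k × L G ℓ k u) ⊎ L G i k u ⊎ L G j k u)))

  data RStep : LGraph → LGraph → Set₁ where
    ar : ∀ G i k → E G i k → (∀ t → ¬ L G i k t) → RStep G (arOp G i k)
    tr : ∀ G i j k t → E G i k → E G j k → i ≢ j →
         L G i k t → L G j k t → RStep G (trOp G j k t)
    cr : ∀ G i j k ℓ → E G i k → E G j k → i ≢ j → ℓ < k →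
         (∀ t → (L G i k t ⊎ L G j k t) → TX ℓ t) → RStep G (crOp G i j k ℓ)

  Generative : Term → ℕ → Set
  Generative x n = n ≤ N × CbarX n x × (∀ k → k ≤ N → CbarX k x → n ≤ k)

{-# OPTIONS --safe #-}
-- The x-generative node is the step at which x first enters the instance, and
-- minimality makes it unique.  For the paths, two properties of the labels hold
-- in G_δ and survive every reduction: a non-constant term labelling (X_i, X_k)
-- lies on a forward arc and occurs in X_i; and a non-constant term of X_k that
-- occurs in an earlier node labels some arc into X_k.  In G_δ the latter holds
-- because such a term is the image of a frontier variable (existential variables
-- get fresh nulls); tr leaves a copy of the removed label on the other arc, and
-- cr moves the labels to the new arc.  Following labels backwards from X_k
-- therefore reaches the generative node through strictly smaller indices.
module Submission where

open import Defs
open import Data.Nat using (ℕ; zero; suc; _≤_; _<_; z≤n; s≤s; _≟_; _≤?_)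
open import Data.Nat.Properties
  using (≤-refl; ≤-trans; ≤-antisym; ≤-pred; <⇒≤; <-≤-trans; ≤∧≢⇒<; ≰⇒>; m≤n⇒m≤1+n; n≮n; n≮0)
open import Data.Nat.Induction using (<-rec)
open import Data.List using (List; []; _∷_; map; concat; take)
open import Data.List.Properties using (≡-dec)
open import Data.List.Relation.Unary.All using (All)
import Data.List.Relation.Unary.All as All
open import Data.List.Relation.Unary.Any using (any?)
open import Data.List.Membership.Propositional using (_∈_; find; lose)
open import Data.List.Membership.Propositional.Properties using (∈-map⁻; ∈-map⁺; ∈-++⁻; ∈-++⁺ˡ; ∈-++⁺ʳ)
open import Data.List.Membership.DecPropositional using () renaming (_∈?_ to ∈-dec)
open import Data.Product using (Σ; ∃; _×_; _,_; proj₁; proj₂; uncurry)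
open import Data.Sum using (_⊎_; inj₁; inj₂)
import Data.Sum as Sum
open import Data.Maybe using (just)
open import Data.Empty using (⊥-elim)
open import Function using (_∘_; id)
open import Relation.Nullary using (¬_; Dec; yes; no)
open import Relation.Nullary.Decidable using (map′; _×-dec_)
open import Relation.Unary using (Decidable)
open import Relation.Binary.Definitions using (DecidableEquality)
open import Relation.Binary.PropositionalEquality using (_≡_; _≢_; refl; cong; cong₂; subst)
open import Relation.Binary.Construct.Closure.ReflexiveTransitive using (Star; ε; _◅_)

_≟ᵀ_ : DecidableEquality Term
cst m ≟ᵀ cst n = map′ (cong cst) (λ { refl → refl }) (m ≟ n)
var m ≟ᵀ var n = map′ (cong var) (λ { refl → refl }) (m ≟ n)
nul m ≟ᵀ nul n = map′ (cong nul) (λ { refl → refl }) (m ≟ n)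
cst _ ≟ᵀ var _ = no λ ()
cst _ ≟ᵀ nul _ = no λ ()
var _ ≟ᵀ cst _ = no λ ()
var _ ≟ᵀ nul _ = no λ ()
nul _ ≟ᵀ cst _ = no λ ()
nul _ ≟ᵀ var _ = no λ ()

_≟ᴬ_ : DecidableEquality Atom
atom p ts ≟ᴬ atom q us =
  map′ (uncurry (cong₂ atom)) (λ { refl → refl , refl }) ((p ≟ q) ×-dec ≡-dec _≟ᵀ_ ts us)

_∈T?_ : ∀ t As → Dec (t ∈T As)
t ∈T? As = map′ find (λ (a , a∈ , t∈) → lose a∈ t∈) (any? (λ a → ∈-dec _≟ᵀ_ t (args a)) As)

_∈ᴬ?_ : ∀ a As → Dec (a ∈ As)
_∈ᴬ?_ = ∈-dec _≟ᴬ_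

monotone-least : {P : ℕ → Set} → Decidable P → (∀ {i j} → i ≤ j → P i → P j) →
                 ∀ {n} → P n → ∃ λ i → i ≤ n × P i × (∀ {k} → P k → i ≤ k)
monotone-least P? mono {zero} p = zero , z≤n , p , λ _ → z≤n
monotone-least {P} P? mono {suc n} p with P? n
... | yes pn = let i , i≤n , pi , least = monotone-least P? mono pn
               in i , m≤n⇒m≤1+n i≤n , pi , least
... | no ¬pn = suc n , ≤-refl , p , above
  where
  above : ∀ {k} → P k → suc n ≤ k
  above {k} pk with suc n ≤? k
  ... | yes n<k = n<k
  ... | no n≮k = ⊥-elim (¬pn (mono (≤-pred (≰⇒> n≮k)) pk))

Path-map : ∀ {E P Q a b} → (∀ {x} → P x → Q x) → Path E P a b → Path E Q a b
Path-map f (here pa)      = here (f pa)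
Path-map f (step pa e ps) = step (f pa) e (Path-map f ps)

Path-snoc : ∀ {E P a b c} → Path E P a b → E b c → P c → Path E P a c
Path-snoc (here pa)       e pc = step pa e (here pc)
Path-snoc (step pa e′ ps) e pc = step pa e′ (Path-snoc ps e pc)

ProducedAt : List Step → ℕ → Atom → Set
ProducedAt ss j a = ∃ λ s → stepAt ss j ≡ just s × a ∈ produced s

∈-derived⁻ : ∀ ss i {a} → a ∈ concat (map produced (take i ss)) → ∃ λ j → j < i × ProducedAt ss j a
∈-derived⁻ []       zero    ()
∈-derived⁻ []       (suc i) ()
∈-derived⁻ (s ∷ ss) zero    ()
∈-derived⁻ (s ∷ ss) (suc i) a∈ with ∈-++⁻ (produced s) a∈
... | inj₁ a∈s  = zero , s≤s z≤n , s , refl , a∈s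
... | inj₂ a∈ss = let j , j<i , p = ∈-derived⁻ ss i a∈ss in suc j , s≤s j<i , p

∈-derived⁺ : ∀ ss {i j a} → j < i → ProducedAt ss j a → a ∈ concat (map produced (take i ss))
∈-derived⁺ []       _                         (_ , () , _)
∈-derived⁺ (s ∷ ss) {j = zero}  (s≤s _)   (_ , refl , a∈s) = ∈-++⁺ˡ a∈s
∈-derived⁺ (s ∷ ss) {j = suc j} (s≤s j<i) p = ∈-++⁺ʳ (produced s) (∈-derived⁺ ss j<i p)

module _ (R : List Rule) (D : List Atom) (ss : List Step) where

  ∈-inst⁻ : ∀ {i a} → a ∈ inst D ss i → a ∈ D ⊎ ∃ λ j → j < i × ProducedAt ss j a
  ∈-inst⁻ {i} a∈ = Sum.map₂ (∈-derived⁻ ss i) (∈-++⁻ D a∈)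

  ∈-inst⁺ : ∀ {i j a} → j < i → ProducedAt ss j a → a ∈ inst D ss i
  ∈-inst⁺ j<i p = ∈-++⁺ʳ D (∈-derived⁺ ss j<i p)

  inst-mono : ∀ {i j a} → i ≤ j → a ∈ inst D ss i → a ∈ inst D ss j
  inst-mono i≤j a∈ with ∈-inst⁻ a∈
  ... | inj₁ a∈D           = ∈-++⁺ˡ a∈D
  ... | inj₂ (k , k<i , p) = ∈-inst⁺ (<-≤-trans k<i i≤j) p

  ∈T-inst-mono : ∀ {i j t} → i ≤ j → t ∈T inst D ss i → t ∈T inst D ss j
  ∈T-inst-mono i≤j (a , a∈ , t∈) = a , inst-mono i≤j a∈ , t∈

  AtX⇒∈inst : ∀ k {a} → AtX R D ss k a → a ∈ inst D ss k
  AtX⇒∈inst zero    a∈D              = ∈-++⁺ˡ a∈D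
  AtX⇒∈inst (suc i) (s , eq , a∈s , _) = ∈-inst⁺ ≤-refl (s , eq , a∈s)

  AtX⇒earliest : ∀ i {a j} → AtX R D ss i a → a ∈ inst D ss j → i ≤ j
  AtX⇒earliest zero    _ _ = z≤n
  AtX⇒earliest (suc i) {j = j} (_ , _ , _ , a∉) a∈ with suc i ≤? j
  ... | yes i<j = i<j
  ... | no  i≮j = ⊥-elim (a∉ (inst-mono (≤-pred (≰⇒> i≮j)) a∈))

  earliest⇒AtX : ∀ i {a} → a ∈ inst D ss i → (∀ {j} → a ∈ inst D ss j → i ≤ j) → AtX R D ss i a
  earliest⇒AtX zero    a∈ earliest with ∈-inst⁻ {zero} a∈
  ... | inj₁ a∈D = a∈D
  earliest⇒AtX (suc i) a∈ earliest with ∈-inst⁻ {suc i} a∈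
  ... | inj₁ a∈D = ⊥-elim (n≮0 (earliest (∈-++⁺ˡ a∈D)))
  ... | inj₂ (j , s≤s j≤i , s , eq , a∈s)
    with ≤-antisym j≤i (≤-pred (earliest (∈-inst⁺ ≤-refl (s , eq , a∈s))))
  ... | refl = s , eq , a∈s , λ a∈i → n≮n i (earliest a∈i)

  ∈inst⇒AtX : ∀ {j a} → a ∈ inst D ss j → ∃ λ ℓ → ℓ ≤ j × AtX R D ss ℓ a
  ∈inst⇒AtX {a = a} a∈ =
    let ℓ , ℓ≤j , a∈ℓ , earliest = monotone-least (a ∈ᴬ?_ ∘ inst D ss) inst-mono a∈
    in ℓ , ℓ≤j , earliest⇒AtX ℓ a∈ℓ earliest

  CbarX⇒∈T : ∀ k {x} → CbarX R D ss k x → x ∈T inst D ss k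
  CbarX⇒∈T k (inj₁ (a , a∈k , x∈a) , _) = a , AtX⇒∈inst k a∈k , x∈a
  CbarX⇒∈T k (inj₂ x∈C , x∉C)           = ⊥-elim (x∉C x∈C)

  Generative-unique : ∀ {x m n} → Generative R D ss x m → Generative R D ss x n → m ≡ n
  Generative-unique (m≤N , x∈m , m-least) (n≤N , x∈n , n-least) =
    ≤-antisym (m-least _ n≤N x∈n) (n-least _ m≤N x∈m)

  generative-exists : ∀ {x} → CbarI R D ss x → ∃ λ n → Generative R D ss x n
  generative-exists {x} (x∈I , x∉C) =
    let n , n≤N , (a , a∈n , x∈a) , earliest =
          monotone-least (λ i → x ∈T? inst D ss i) ∈T-inst-mono x∈I
        a∈Xn = earliest⇒AtX n a∈n (λ a∈j → earliest (a , a∈j , x∈a))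
    in n , n≤N , (inj₁ (a , a∈Xn , x∈a) , x∉C) , λ k _ x∈k → earliest (CbarX⇒∈T k x∈k)

  record LabelInvariant (G : LGraph) : Set where
    field
      label-on-forward-arc  : ∀ {i k x} → L G i k x → ¬ InC R D ss x →
                              E G i k × i < k × TX R D ss i x
      earlier-term-labelled : ∀ {m k x} → m < k → CbarX R D ss m x → CbarX R D ss k x →
                              ∃ λ i → L G i k x
  open LabelInvariant

  ar-preserves : ∀ {G i k} → (∀ t → ¬ L G i k t) →
                 LabelInvariant G → LabelInvariant (arOp R D ss G i k)
  ar-preserves empty inv .label-on-forward-arc (lab , ≢ik) x∉C =
    let e , i<k , x∈i = inv .label-on-forward-arc lab x∉C in (e , ≢ik) , i<k , x∈i
  ar-preserves empty inv .earlier-term-labelled m<k x∈m x∈k =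
    let i , lab = inv .earlier-term-labelled m<k x∈m x∈k
    in i , lab , λ { (refl , refl) → empty _ lab }

  tr-preserves : ∀ {G i j k t} → i ≢ j → L G i k t →
                 LabelInvariant G → LabelInvariant (trOp R D ss G j k t)
  tr-preserves i≢j lab-ik inv .label-on-forward-arc (lab , _) = inv .label-on-forward-arc lab
  tr-preserves {j = j} {k} {t} i≢j lab-ik inv .earlier-term-labelled {k = k′} {x} m<k x∈m x∈k
    with inv .earlier-term-labelled m<k x∈m x∈k
  ... | i′ , lab with (i′ ≟ j) ×-dec (k′ ≟ k) ×-dec (x ≟ᵀ t)
  ... | yes (refl , refl , refl) = _ , lab-ik , λ (i≡j , _) → i≢j i≡j
  ... | no  removed              = i′ , lab , removed

  cr-preserves : ∀ {G i j k ℓ} → ℓ < k → (∀ t → L G i k t ⊎ L G j k t → TX R D ss ℓ t) →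
                 LabelInvariant G → LabelInvariant (crOp R D ss G i j k ℓ)
  cr-preserves ℓ<k merged inv .label-on-forward-arc (inj₁ (_ , lab , ≢ik , ≢jk)) x∉C =
    let e , a<b , x∈a = inv .label-on-forward-arc lab x∉C in inj₁ (e , ≢ik , ≢jk) , a<b , x∈a
  cr-preserves ℓ<k merged inv .label-on-forward-arc (inj₂ (refl , refl , inj₁ (_ , lab))) x∉C =
    inj₂ (refl , refl) , ℓ<k , proj₂ (proj₂ (inv .label-on-forward-arc lab x∉C))
  cr-preserves ℓ<k merged inv .label-on-forward-arc (inj₂ (refl , refl , inj₂ lab)) x∉C =
    inj₂ (refl , refl) , ℓ<k , merged _ lab
  cr-preserves {i = i} {j} {k} {ℓ} ℓ<k merged inv .earlier-term-labelled {k = k′} m<k x∈m x∈k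
    with inv .earlier-term-labelled m<k x∈m x∈k
  ... | i′ , lab with (i′ ≟ ℓ) ×-dec (k′ ≟ k)
  ... | yes (refl , refl) =
    ℓ , inj₂ (refl , refl , inj₁ (proj₁ (inv .label-on-forward-arc lab (proj₂ x∈k)) , lab))
  ... | no ≢ℓk with (i′ ≟ i) ×-dec (k′ ≟ k)
  ... | yes (refl , refl) = ℓ , inj₂ (refl , refl , inj₂ (inj₁ lab))
  ... | no ≢ik with (i′ ≟ j) ×-dec (k′ ≟ k)
  ... | yes (refl , refl) = ℓ , inj₂ (refl , refl , inj₂ (inj₂ lab))
  ... | no ≢jk = i′ , inj₁ (≢ℓk , lab , ≢ik , ≢jk)

  RStep-preserves : ∀ {G G′} → RStep R D ss G G′ → LabelInvariant G → LabelInvariant G′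
  RStep-preserves (ar G i k _ empty)              = ar-preserves empty
  RStep-preserves (tr G i j k t _ _ i≢j lab-ik _) = tr-preserves i≢j lab-ik
  RStep-preserves (cr G i j k ℓ _ _ _ ℓ<k merged) = cr-preserves ℓ<k merged

  Star-preserves : ∀ {G G′} → Star (RStep R D ss) G G′ → LabelInvariant G → LabelInvariant G′
  Star-preserves ε        = id
  Star-preserves (r ◅ rs) = Star-preserves rs ∘ RStep-preserves r

  path-from-generative : ∀ {G x n} → LabelInvariant G → Generative R D ss x n →
    ∀ k → k ≤ N R D ss → CbarX R D ss k x →
    Path (E G) (λ ℓ → ℓ ≤ k × CbarX R D ss ℓ x) n k
  path-from-generative {G} {x} {n} inv (_ , x∈n , n-least) = <-rec Goal go
    where
    Goal : ℕ → Set
    Goal k = k ≤ N R D ss → CbarX R D ss k x → Path (E G) (λ ℓ → ℓ ≤ k × CbarX R D ss ℓ x) n k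

    go : ∀ k → (∀ {ℓ} → ℓ < k → Goal ℓ) → Goal k
    go k rec k≤N x∈k with n ≟ k
    ... | yes refl = here (≤-refl , x∈k)
    ... | no  n≢k  =
      let i , lab       = inv .earlier-term-labelled (≤∧≢⇒< (n-least k k≤N x∈k) n≢k) x∈n x∈k
          e , i<k , x∈i = inv .label-on-forward-arc lab (proj₂ x∈k)
          path-to-i     = rec i<k (≤-trans (<⇒≤ i<k) k≤N) (x∈i , proj₂ x∈k)
      in Path-snoc (Path-map (λ (ℓ≤i , x∈ℓ) → ≤-trans ℓ≤i (<⇒≤ i<k) , x∈ℓ) path-to-i) e (≤-refl , x∈k)

  module _ (wf : All RuleWF R) (vd : ValidDeriv R D ss) where

    frontier-image-labelled : ∀ {j s v x} → stepAt ss j ≡ just s → Frontier (rl s) v →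
                              x ≡ h s v → ¬ InC R D ss x → ∃ λ i → L₀ R D ss i (suc j) x
    frontier-image-labelled {j} {s} eq fr@((a , a∈body , v∈a) , _) x≡hv x∉C =
      let _ , homo , _  = vd j s eq
          i , _ , ha∈i = ∈inst⇒AtX {j} (homo a a∈body)
      in i , s , eq , a , (a∈body , _ , v∈a , fr) , ha∈i , _ , v∈a , fr , x≡hv , x∉C

    produced-term-labelled : ∀ {j s b x} → stepAt ss j ≡ just s → b ∈ produced s → x ∈ args b →
                             ¬ InC R D ss x → x ∈T inst D ss j → ∃ λ i → L₀ R D ss i (suc j) x
    produced-term-labelled {j} {s} eq b∈s x∈b x∉C x∈j with vd j s eq
    ... | ρ∈R , _ , extends , fresh , _ with ∈-map⁻ (substA (hb s)) b∈s
    ... | c , c∈head , refl with ∈-map⁻ (substT (hb s)) x∈b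
    ... | cst n , t∈c , refl = ⊥-elim (x∉C ((n , refl) , inj₂ (rl s , ρ∈R , inj₂ (c , c∈head , t∈c))))
    ... | nul n , t∈c , refl = ⊥-elim (proj₂ (All.lookup wf ρ∈R) n (c , c∈head , t∈c))
    ... | var v , t∈c , refl with var v ∈T? body (rl s)
    ... | yes v∈body = frontier-image-labelled eq (v∈body , c , c∈head , t∈c) (extends v v∈body) x∉C
    ... | no  v∉body =
      let n , hv≡n , n∉j = fresh v ((c , c∈head , t∈c) , v∉body)
      in ⊥-elim (n∉j (subst (_∈T inst D ss j) hv≡n x∈j))

    Gδ-invariant : LabelInvariant (Gδ R D ss)
    Gδ-invariant .label-on-forward-arc {k = zero} ()
    Gδ-invariant .label-on-forward-arc {i} {suc j} (s , eq , a , fa , ha∈i , v , v∈a , _ , refl , _) _ =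
      (s , eq , a , fa , ha∈i) ,
      s≤s (AtX⇒earliest i ha∈i (proj₁ (proj₂ (vd j s eq)) a (proj₁ fa))) ,
      inj₁ (_ , ha∈i , ∈-map⁺ (substT (h s)) v∈a)
    Gδ-invariant .earlier-term-labelled {k = zero} ()
    Gδ-invariant .earlier-term-labelled {m} {suc j} (s≤s m≤j) x∈m (inj₁ (b , (s , eq , b∈s , _) , x∈b) , x∉C) =
      produced-term-labelled eq b∈s x∈b x∉C (∈T-inst-mono m≤j (CbarX⇒∈T m x∈m))
    Gδ-invariant .earlier-term-labelled {k = suc j} _ _ (inj₂ x∈C , x∉C) = ⊥-elim (x∉C x∈C)

lemma7 : (R : List Rule) (D : List Atom) (ss : List Step) →
    All RuleWF R → Database D → ValidDeriv R D ss →
    (G : LGraph) → Star (RStep R D ss) (Gδ R D ss) G →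
    ((x : Term) → CbarI R D ss x →
      Σ ℕ (λ n → Generative R D ss x n × ((m : ℕ) → Generative R D ss x m → m ≡ n)))
    ×
    ((x : Term) (n k : ℕ) → Generative R D ss x n → k ≤ N R D ss → CbarX R D ss k x →
      Path (E G) (λ ℓ → ℓ ≤ k × CbarX R D ss ℓ x) n k)
lemma7 R D ss wf _ vd G Gδ⇝G = unique-generative , λ x n k gen → path-from-generative R D ss inv gen k
  where
  inv : LabelInvariant R D ss G
  inv = Star-preserves R D ss Gδ⇝G (Gδ-invariant R D ss wf vd)

  unique-generative : ∀ x → CbarI R D ss x →
    Σ ℕ (λ n → Generative R D ss x n × ((m : ℕ) → Generative R D ss x m → m ≡ n))
  unique-generative x x∈I =
    let n , gen = generative-exists R D ss x∈I
    in n , gen , λ m gen′ → Generative-unique R D ss gen′ gen
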